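{- Let $N$ be a positive integer and let $\Pi=\bigcup_{1\le i<j\le 4}\bigcup_{ -N\le r\le N}\{(e_i,f_{ij}^r),(e_j,f_{ij}^r)\}\subset\mathbb R^4\times\mathbb R^{6(2N+1)}$, where $e_1,\dots,e_4$ is the standard basis of $\mathbb R^4$ and the symbols $f_{ij}^r$ (distinct $i,j\in[4]$, $-N\le r\le N$), identified via $f_{ij}^r=f_{ji}^{ -r}$, form the standard basis of $\mathbb R^{6(2N+1)}$. For distinct $i,j,k\in[4]$ and $-N\le r,s,t\le N$, let $X_{ijk}^{rst}$ be the circuit with affine dependence $(e_i,f_{ij}^r)-(e_j,f_{ij}^r)+(e_j,f_{jk}^s)-(e_k,f_{jk}^s)+(e_k,f_{ki}^t)-(e_i,f_{ki}^t)=0$, with positive part $(X_{ijk}^{rst})^+=\{(e_i,f_{ij}^r),(e_j,f_{jk}^s),(e_k,f_{ki}^t)\}$ and negative part the remaining three points, and let $\mathcal T_{ijk}^{rst}:=\{\sigma\subseteq X_{ijk}^{rst}:\sigma\not\supseteq(X_{ijk}^{rst})^+\}$. Let $\mathcal T$ be a triangulation of $\Pi$ with $\mathcal T_{ijk}^{rst}\subseteq\mathcal T$, and let $\mathcal T'$ be the result of a flip on $\mathcal T$ which is not supported on $X_{ijk}^{rst}$. Then $\mathcal T_{ijk}^{rst}\subseteq\mathcal T'$.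
   Context: A triangulation of a finite point set $A$ is a collection of affinely independent subsets (simplices) of $A$, closed under faces, whose convex hulls cover $\mathrm{conv}(A)$ and intersect pairwise in convex hulls of common faces. For a circuit $X=(X^+,X^-)$ (minimal affinely dependent set split by signs of its affine dependence), $\mathcal T_X^{\pm}:=\{\sigma\subseteq X:\sigma\not\supseteq X^{\pm}\}$. The link of $C$ in $\mathcal T$ is $\{C'\in\mathcal T:C\cap C'=\emptyset,\ C\cup C'\in\mathcal T\}$. $\mathcal T$ has a flip supported on $(X^+,X^-)$ if $\mathcal T_X^+\subseteq\mathcal T$ and all maximal simplices of $\mathcal T_X^+$ have the same link $\mathcal L$ in $\mathcal T$; the result of the flip is $\mathcal T\setminus\{\rho\cup\sigma:\rho\in\mathcal L,\sigma\in\mathcal T_X^+\}\cup\{\rho\cup\sigma:\rho\in\mathcal L,\sigma\in\mathcal T_X^-\}$. -}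

module Defs where

open import Data.Nat using (ℕ; zero; suc; _+_)
open import Data.Fin using (Fin; zero; suc; punchIn; opposite; _≟_; _<?_)
open import Data.Bool using (Bool; true; false; _∧_; _∨_; not; T; if_then_else_)
open import Data.Product using (Σ; ∃; _×_; _,_; ∃-syntax)
open import Data.Sum using (_⊎_; inj₁; inj₂)
open import Data.Empty using (⊥)
open import Data.Rational using (ℚ; 0ℚ; 1ℚ) renaming (_+_ to _+q_; _*_ to _*q_; _≤_ to _≤q_; _<_ to _<q_)
open import Relation.Nullary using (¬_)
open import Relation.Nullary.Decidable using (⌊_⌋)
open import Relation.Binary.PropositionalEquality using (_≡_; _≢_)

-- An index r : Shift N (i.e. r ∈ {0,…,2N}) represents the integer r - N ∈ [-N, N].
-- Negation of the integer corresponds to 'opposite'.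
Shift : ℕ → Set
Shift N = Fin (suc (N + N))

-- A point of Π is (e_a , f_{ab}^r) with a ≠ b; we encode b = punchIn a c
-- with c : Fin 3, which enumerates exactly the b ≠ a.
record Pt (N : ℕ) : Set where
  constructor pt
  field
    src   : Fin 4
    off   : Fin 3
    shift : Shift N
open Pt public

tgt : ∀ {N} → Pt N → Fin 4
tgt p = punchIn (src p) (off p)

_=F_ : ∀ {n} → Fin n → Fin n → Bool
a =F b = ⌊ a ≟ b ⌋

isPt : ∀ {N} → Fin 4 → Fin 4 → Shift N → Pt N → Bool
isPt a b r p = (src p =F a) ∧ ((tgt p =F b) ∧ (shift p =F r))

-- Coordinates of R^4 × R^{6(2N+1)}: eC i is the e_i coordinate; fC c d s
-- with c < d is the coordinate of f_{cd}^s (f_{dc}^{-s} is the same vector).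
-- Indices fC c d s with c ≥ d are extra coordinates that vanish on all of Π.
data Coord (N : ℕ) : Set where
  eC : Fin 4 → Coord N
  fC : Fin 4 → Fin 4 → Shift N → Coord N

coord : ∀ {N} → Pt N → Coord N → ℚ
coord p (eC i) = if src p =F i then 1ℚ else 0ℚ
coord p (fC c d s) =
  if ⌊ c <? d ⌋ ∧ (((src p =F c) ∧ ((tgt p =F d) ∧ (shift p =F s)))
                 ∨ ((tgt p =F c) ∧ ((src p =F d) ∧ (opposite (shift p) =F s))))
  then 1ℚ else 0ℚ

ΣF : (n : ℕ) → (Fin n → ℚ) → ℚ
ΣF zero f = 0ℚ
ΣF (suc n) f = f zero +q ΣF n (λ i → f (suc i))

Σpt : ∀ {N} → (Pt N → ℚ) → ℚ
Σpt {N} f = ΣF 4 λ a → ΣF 3 λ c → ΣF (suc (N + N)) λ r → f (pt a c r)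

Point : ℕ → Set
Point N = Coord N → ℚ

combo : ∀ {N} → (Pt N → ℚ) → Point N
combo w k = Σpt (λ p → w p *q coord p k)

Subset : ℕ → Set
Subset N = Pt N → Bool

Coll : ℕ → Set₁
Coll N = Subset N → Set

full : ∀ {N} → Subset N
full _ = true

_⊆_ : ∀ {N} → Subset N → Subset N → Set
σ ⊆ τ = ∀ p → T (σ p) → T (τ p)

_≐_ : ∀ {N} → Subset N → Subset N → Set
σ ≐ τ = ∀ p → σ p ≡ τ p

_∪_ : ∀ {N} → Subset N → Subset N → Subset N
(σ ∪ τ) p = σ p ∨ τ p

_∩_ : ∀ {N} → Subset N → Subset N → Subset N
(σ ∩ τ) p = σ p ∧ τ p

Disjoint : ∀ {N} → Subset N → Subset N → Set
Disjoint σ τ = ∀ p → T (σ p) → T (τ p) → ⊥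

SupportedIn : ∀ {N} → (Pt N → ℚ) → Subset N → Set
SupportedIn w σ = ∀ p → T (not (σ p)) → w p ≡ 0ℚ

InConv : ∀ {N} → Subset N → Point N → Set
InConv σ x = ∃[ w ] ((∀ p → 0ℚ ≤q w p) × SupportedIn w σ × (Σpt w ≡ 1ℚ)
                     × (∀ k → combo w k ≡ x k))

AffIndep : ∀ {N} → Subset N → Set
AffIndep σ = ∀ μ → SupportedIn μ σ → Σpt μ ≡ 0ℚ → (∀ k → combo μ k ≡ 0ℚ)
             → ∀ p → μ p ≡ 0ℚ

IsTriangulation : ∀ {N} → Coll N → Set
IsTriangulation {N} 𝒯 =
  (∀ σ τ → 𝒯 σ → τ ⊆ σ → 𝒯 τ)
  × (∀ σ → 𝒯 σ → AffIndep σ)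
  × (∀ (x : Point N) → InConv full x → ∃[ σ ] (𝒯 σ × InConv σ x))
  × (∀ σ τ (x : Point N) → 𝒯 σ → 𝒯 τ → InConv σ x → InConv τ x → InConv (σ ∩ τ) x)

IsCircuit : ∀ {N} → Subset N → Subset N → Set
IsCircuit Xp Xm =
  (∃[ μ ] ((∀ p → T (Xp p) → 0ℚ <q μ p) × (∀ p → T (Xm p) → μ p <q 0ℚ)
           × SupportedIn μ (Xp ∪ Xm) × (Σpt μ ≡ 0ℚ) × (∀ k → combo μ k ≡ 0ℚ)))
  × (∀ τ → τ ⊆ (Xp ∪ Xm) → ¬ ((Xp ∪ Xm) ⊆ τ) → AffIndep τ)

TX : ∀ {N} → Subset N → Subset N → Coll N
TX Xp Xm σ = σ ⊆ (Xp ∪ Xm) × ¬ (Xp ⊆ σ)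

MaxIn : ∀ {N} → Coll N → Subset N → Set
MaxIn 𝒮 σ = 𝒮 σ × (∀ τ → 𝒮 τ → σ ⊆ τ → τ ⊆ σ)

LinkIn : ∀ {N} → Coll N → Subset N → Coll N
LinkIn 𝒯 C C' = Disjoint C C' × 𝒯 C' × 𝒯 (C ∪ C')

HasFlip : ∀ {N} → Coll N → Subset N → Subset N → Coll N → Set
HasFlip 𝒯 Xp Xm ℒ =
  (∀ σ → TX Xp Xm σ → 𝒯 σ)
  × (∀ σ → MaxIn (TX Xp Xm) σ → ∀ ρ → (LinkIn 𝒯 σ ρ → ℒ ρ) × (ℒ ρ → LinkIn 𝒯 σ ρ))

FlipResult : ∀ {N} → Coll N → Subset N → Subset N → Coll N → Coll N
FlipResult 𝒯 Xp Xm ℒ τ =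
  (𝒯 τ × ¬ (∃[ ρ ] ∃[ σ ] (ℒ ρ × TX Xp Xm σ × τ ≐ (ρ ∪ σ))))
  ⊎ (∃[ ρ ] ∃[ σ ] (ℒ ρ × TX Xm Xp σ × τ ≐ (ρ ∪ σ)))

IsFlipOn : ∀ {N} → Coll N → Coll N → Subset N → Subset N → Set₁
IsFlipOn 𝒯 𝒯' Yp Ym =
  IsCircuit Yp Ym
  × ∃[ ℒ ] (HasFlip 𝒯 Yp Ym ℒ
            × (∀ τ → (𝒯' τ → FlipResult 𝒯 Yp Ym ℒ τ) × (FlipResult 𝒯 Yp Ym ℒ τ → 𝒯' τ)))

Xplus : ∀ {N} → Fin 4 → Fin 4 → Fin 4 → Shift N → Shift N → Shift N → Subset N
Xplus i j k r s t p = isPt i j r p ∨ (isPt j k s p ∨ isPt k i t p)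

Xminus : ∀ {N} → Fin 4 → Fin 4 → Fin 4 → Shift N → Shift N → Shift N → Subset N
Xminus i j k r s t p =
  isPt j i (opposite r) p ∨ (isPt k j (opposite s) p ∨ isPt i k (opposite t) p)

-- A simplex τ of 𝒯 survives unless Y⁻ ⊆ τ ⊉ Y⁺:
-- for y ∈ Y⁺ ∖ τ, the set Y ∖ {y} is a maximal simplex of 𝒯_Y⁺, hence has link ℒ, so τ is
-- removed iff (Y ∖ {y}) ∪ (τ ∖ Y) ∈ 𝒯, and then it is added back as (τ ∖ Y) ∪ (τ ∩ Y).  This
-- case distinction is constructive because membership in a triangulation is decidable: a
-- nonempty S is a simplex iff it is a face of a simplex whose hull holds its barycentre.
--
-- For τ ∈ 𝒯_X⁺ it remains to exclude Y⁻ ⊆ τ ⊆ X.  Each coordinate f_{ab}^u is nonzero on exactly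
-- two points of Π, a point and its partner, and each coordinate e_a on exactly two points of X.
-- So an affine dependence with Y⁻ ⊆ X is supported on X and is a multiple of the dependence of
-- X, i.e. Y = ±X; but Y ≠ X by hypothesis, and Y = -X would give X⁺ = Y⁻ ⊆ τ.

module Submission where

open import Defs
open import Data.Nat using (ℕ; zero; suc; _≤_)
open import Data.Fin using (Fin; zero; suc; punchOut; opposite; _≟_; _<_; _<?_)
open import Data.Fin.Properties
  using (any?; <-cmp; suc-injective; punchIn-injective; punchInᵢ≢i; punchIn-punchOut; opposite-involutive)
open import Data.Bool using (Bool; true; false; _∧_; _∨_; not; T; if_then_else_)
open import Data.Bool.Properties using (T-∧; T-∨; ∨-comm)
open import Data.Product using (∃; _×_; _,_; proj₁; proj₂; ∃-syntax)
open import Data.Product.Function.NonDependent.Propositional using (_×-⇔_)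
open import Data.Sum using (_⊎_; inj₁; inj₂; [_,_]; [_,_]′)
import Data.Sum as Sum
open import Data.Sum.Function.Propositional using (_⊎-⇔_)
open import Data.Empty using (⊥-elim)
open import Data.Unit using (tt)
open import Data.Rational using (ℚ; 0ℚ; 1ℚ; -_; _-_; _+_; _*_; 1/_; Positive; NonZero; positive)
  renaming (_≤_ to _≤q_; _<_ to _<q_)
import Data.Rational.Properties as ℚ
open import Data.Rational.Solver using (module +-*-Solver)
open import Algebra.Properties.Group ℚ.+-0-group using (inverseˡ-unique; inverseʳ-unique; x∙y⁻¹≈ε⇒x≈y)
open import Function using (_⇔_; mk⇔; Equivalence; _∘_; id)
open import Function.Properties.Equivalence using ()
  renaming (refl to ⇔-refl; sym to ⇔-sym; trans to infixr 0 _⟨⇔⟩_)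
open import Relation.Nullary using (¬_; Dec; yes; no; contradiction)
open import Relation.Nullary.Decidable
  using (⌊_⌋; toWitness; fromWitness; map′; toSum; _×-dec_; ¬?; T?; decidable-stable)
open import Relation.Binary.Definitions using (DecidableEquality; tri<; tri≈; tri>)
open import Relation.Binary.PropositionalEquality
  using (_≡_; _≢_; refl; sym; trans; cong; cong₂; subst; ≢-sym; module ≡-Reasoning)

open Equivalence using (to; from)
open +-*-Solver using (solve; _:+_; _:-_; _:*_; _:=_)

T-⌊⌋ : ∀ {A : Set} (a? : Dec A) → T ⌊ a? ⌋ ⇔ A
T-⌊⌋ _ = mk⇔ toWitness fromWitness

T-⌊⌋∧³ : ∀ {A B C : Set} (a? : Dec A) (b? : Dec B) (c? : Dec C) →
         T (⌊ a? ⌋ ∧ (⌊ b? ⌋ ∧ ⌊ c? ⌋)) ⇔ (A × B × C)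
T-⌊⌋∧³ a? b? c? = T-∧ {⌊ a? ⌋} ⟨⇔⟩ (T-⌊⌋ a? ×-⇔ (T-∧ {⌊ b? ⌋} ⟨⇔⟩ (T-⌊⌋ b? ×-⇔ T-⌊⌋ c?)))

T-not : ∀ {b} → T (not b) ⇔ (¬ T b)
T-not {false} = mk⇔ (λ _ ()) (λ _ → _)
T-not {true}  = mk⇔ (λ ()) (λ ¬t → ¬t _)

T-injective : ∀ {a b} → (T a ⇔ T b) → a ≡ b
T-injective {false} {false} _ = refl
T-injective {false} {true}  a⇔b = ⊥-elim (from a⇔b _)
T-injective {true}  {false} a⇔b = ⊥-elim (to a⇔b _)
T-injective {true}  {true}  _ = refl

𝟙 : Bool → ℚ
𝟙 b = if b then 1ℚ else 0ℚ

𝟙≡1⇔T : ∀ b → 𝟙 b ≡ 1ℚ ⇔ T b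
𝟙≡1⇔T false = mk⇔ (λ ()) (λ ())
𝟙≡1⇔T true  = mk⇔ _ (λ _ → refl)

𝟙≢1⇒𝟙≡0 : ∀ b → 𝟙 b ≢ 1ℚ → 𝟙 b ≡ 0ℚ
𝟙≢1⇒𝟙≡0 false _ = refl
𝟙≢1⇒𝟙≡0 true  ≢1 = contradiction refl ≢1

𝟙-yes : ∀ {P : Set} (p? : Dec P) → P → 𝟙 ⌊ p? ⌋ ≡ 1ℚ
𝟙-yes (yes _) _ = refl
𝟙-yes (no ¬p) p = contradiction p ¬p

𝟙-no : ∀ {P : Set} (p? : Dec P) → ¬ P → 𝟙 ⌊ p? ⌋ ≡ 0ℚ
𝟙-no (yes p) ¬p = contradiction p ¬p
𝟙-no (no _)  _  = refl

𝟙-nonneg : ∀ b → 0ℚ ≤q 𝟙 b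
𝟙-nonneg false = ℚ.≤-refl
𝟙-nonneg true  = ℚ.<⇒≤ (ℚ.positive⁻¹ 1ℚ)

-- Points and subsets of Π

module _ {N : ℕ} where

  IsPt : Fin 4 → Fin 4 → Shift N → Pt N → Set
  IsPt a b u x = src x ≡ a × tgt x ≡ b × shift x ≡ u

  Pt-≡ : ∀ {x y : Pt N} → src x ≡ src y → tgt x ≡ tgt y → shift x ≡ shift y → x ≡ y
  Pt-≡ {pt a c u} {pt .a c′ .u} refl c≡c′ refl = cong (λ c → pt a c u) (punchIn-injective a c c′ c≡c′)

  _≟Pt_ : DecidableEquality (Pt N)
  pt a c u ≟Pt pt a′ c′ u′ =
    map′ (λ { (refl , refl , refl) → refl }) (λ { refl → refl , refl , refl })
         (a ≟ a′ ×-dec c ≟ c′ ×-dec u ≟ u′)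

  edgePt : (a b : Fin 4) → a ≢ b → Shift N → Pt N
  edgePt a b a≢b u = pt a (punchOut a≢b) u

  edgePt-tgt : ∀ {a b} (a≢b : a ≢ b) u → tgt (edgePt a b a≢b u) ≡ b
  edgePt-tgt a≢b u = punchIn-punchOut a≢b

  IsPt⇔≡edgePt : ∀ {a b u x} (a≢b : a ≢ b) → IsPt a b u x ⇔ x ≡ edgePt a b a≢b u
  IsPt⇔≡edgePt {u = u} a≢b = mk⇔
    (λ (src≡a , tgt≡b , shift≡u) → Pt-≡ src≡a (trans tgt≡b (sym (edgePt-tgt a≢b u))) shift≡u)
    (λ { refl → refl , edgePt-tgt a≢b u , refl })

  isPt⇔≡edgePt : ∀ {a b u x} (a≢b : a ≢ b) → T (isPt a b u x) ⇔ x ≡ edgePt a b a≢b u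
  isPt⇔≡edgePt {a} {b} {u} {x} a≢b =
    T-⌊⌋∧³ (src x ≟ a) (tgt x ≟ b) (shift x ≟ u) ⟨⇔⟩ IsPt⇔≡edgePt a≢b

  partner : Pt N → Pt N
  partner x = edgePt (tgt x) (src x) (punchInᵢ≢i (src x) (off x)) (opposite (shift x))

  partner-tgt : ∀ x → tgt (partner x) ≡ src x
  partner-tgt x = edgePt-tgt (punchInᵢ≢i (src x) (off x)) (opposite (shift x))

  partner-involutive : ∀ x → partner (partner x) ≡ x
  partner-involutive x = Pt-≡ (partner-tgt x) (partner-tgt (partner x)) (opposite-involutive (shift x))

  partner-edgePt : ∀ {a b} (a≢b : a ≢ b) (b≢a : b ≢ a) u →
                   partner (edgePt a b a≢b u) ≡ edgePt b a b≢a (opposite u)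
  partner-edgePt a≢b b≢a u =
    Pt-≡ (edgePt-tgt a≢b u) (trans (partner-tgt (edgePt _ _ a≢b u)) (sym (edgePt-tgt b≢a (opposite u))))
         refl

  partner-swap : ∀ {x y} → partner x ≡ y → x ≡ partner y
  partner-swap {x} x′≡y = trans (sym (partner-involutive x)) (cong partner x′≡y)

  partner-injective : ∀ {x y} → partner x ≡ partner y → x ≡ y
  partner-injective {y = y} x′≡y′ = trans (partner-swap x′≡y′) (partner-involutive y)

  isPt⇔≡partner : ∀ {a b u x} (a≢b : a ≢ b) →
                  T (isPt b a (opposite u) x) ⇔ x ≡ partner (edgePt a b a≢b u)
  isPt⇔≡partner {u = u} a≢b =
    isPt⇔≡edgePt (≢-sym a≢b) ⟨⇔⟩ mk⇔ (λ e → trans e (sym x′≡)) (λ e → trans e x′≡)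
    where x′≡ = partner-edgePt a≢b (≢-sym a≢b) u

  ≢-partner : ∀ x → x ≢ partner x
  ≢-partner x x≡x′ = punchInᵢ≢i (src x) (off x) (sym (cong src x≡x′))

module _ {N : ℕ} where

  ∅ : Subset N
  ∅ _ = false

  ｛_｝ : Pt N → Subset N
  ｛ y ｝ p = ⌊ p ≟Pt y ⌋

  _∖_ : Subset N → Subset N → Subset N
  (σ ∖ τ) p = σ p ∧ not (τ p)

  ∈∖⇔ : ∀ (σ τ : Subset N) {p} → T ((σ ∖ τ) p) ⇔ (T (σ p) × ¬ T (τ p))
  ∈∖⇔ σ τ {p} = T-∧ {σ p} ⟨⇔⟩ (⇔-refl ×-⇔ T-not)

  ∈∪⇔ : ∀ (σ τ : Subset N) {p} → T ((σ ∪ τ) p) ⇔ (T (σ p) ⊎ T (τ p))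
  ∈∪⇔ σ τ {p} = T-∨ {σ p}

  ≐-∖∪∩ : ∀ (σ τ : Subset N) → σ ≐ ((σ ∖ τ) ∪ (σ ∩ τ))
  ≐-∖∪∩ σ τ p with σ p | τ p
  ... | false | _     = refl
  ... | true  | false = refl
  ... | true  | true  = refl

  any-Pt? : {P : Pt N → Set} → (∀ p → Dec (P p)) → Dec (∃ P)
  any-Pt? P? = map′ (λ (a , c , u , Pacu) → pt a c u , Pacu) (λ (p , Pp) → src p , off p , shift p , Pp)
                    (any? λ a → any? λ c → any? λ u → P? (pt a c u))

  ⊆⊎⊈ : ∀ (σ τ : Subset N) → σ ⊆ τ ⊎ ∃[ p ] (T (σ p) × ¬ T (τ p))
  ⊆⊎⊈ σ τ with any-Pt? (λ p → T? (σ p) ×-dec ¬? (T? (τ p)))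
  ... | yes witness = inj₂ witness
  ... | no  ∄       = inj₁ λ p p∈σ → decidable-stable (T? (τ p)) λ p∉τ → ∄ (p , p∈σ , p∉τ)

-- Finite sums

ΣF-cong : ∀ n {f g : Fin n → ℚ} → (∀ i → f i ≡ g i) → ΣF n f ≡ ΣF n g
ΣF-cong zero    _   = refl
ΣF-cong (suc n) f≗g = cong₂ _+_ (f≗g zero) (ΣF-cong n (f≗g ∘ suc))

ΣF-zero : ∀ n {f : Fin n → ℚ} → (∀ i → f i ≡ 0ℚ) → ΣF n f ≡ 0ℚ
ΣF-zero zero    _   = refl
ΣF-zero (suc n) f≗0 = trans (cong₂ _+_ (f≗0 zero) (ΣF-zero n (f≗0 ∘ suc))) (ℚ.+-identityʳ 0ℚ)

ΣF-single : ∀ n {f : Fin n → ℚ} a → (∀ i → i ≢ a → f i ≡ 0ℚ) → ΣF n f ≡ f a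
ΣF-single (suc n) {f} zero    f≗0 =
  trans (cong (f zero +_) (ΣF-zero n (λ i → f≗0 (suc i) λ ()))) (ℚ.+-identityʳ _)
ΣF-single (suc n) (suc a) f≗0 =
  trans (cong₂ _+_ (f≗0 zero λ ()) (ΣF-single n a (λ i i≢a → f≗0 (suc i) (i≢a ∘ suc-injective))))
        (ℚ.+-identityˡ _)

ΣF-sub : ∀ n (f g : Fin n → ℚ) → ΣF n (λ i → f i - g i) ≡ ΣF n f - ΣF n g
ΣF-sub zero    f g = refl
ΣF-sub (suc n) f g = trans (cong (f zero - g zero +_) (ΣF-sub n (f ∘ suc) (g ∘ suc)))
  (solve 4 (λ a b c d → (a :- b) :+ (c :- d) := (a :+ c) :- (b :+ d)) refl
         (f zero) (g zero) (ΣF n (f ∘ suc)) (ΣF n (g ∘ suc)))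

ΣF-*ˡ : ∀ n c (f : Fin n → ℚ) → ΣF n (λ i → c * f i) ≡ c * ΣF n f
ΣF-*ˡ zero    c f = sym (ℚ.*-zeroʳ c)
ΣF-*ˡ (suc n) c f = trans (cong (c * f zero +_) (ΣF-*ˡ n c (f ∘ suc))) (sym (ℚ.*-distribˡ-+ c _ _))

ΣF-nonneg : ∀ n {f : Fin n → ℚ} → (∀ i → 0ℚ ≤q f i) → 0ℚ ≤q ΣF n f
ΣF-nonneg zero    _  = ℚ.≤-refl
ΣF-nonneg (suc n) f≥0 = ℚ.+-mono-≤ (f≥0 zero) (ΣF-nonneg n (f≥0 ∘ suc))

ΣF-pos : ∀ n {f : Fin n → ℚ} → (∀ i → 0ℚ ≤q f i) → ∀ a → 0ℚ <q f a → 0ℚ <q ΣF n f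
ΣF-pos (suc n) f≥0 zero    fa>0 = ℚ.+-mono-<-≤ fa>0 (ΣF-nonneg n (f≥0 ∘ suc))
ΣF-pos (suc n) f≥0 (suc a) fa>0 = ℚ.+-mono-≤-< (f≥0 zero) (ΣF-pos n (f≥0 ∘ suc) a fa>0)

Σ³ : ∀ {l m n} → (Fin l → Fin m → Fin n → ℚ) → ℚ
Σ³ {l} {m} {n} F = ΣF l λ a → ΣF m λ c → ΣF n (F a c)

module _ {l m n : ℕ} where

  Σ³-cong : {F G : Fin l → Fin m → Fin n → ℚ} → (∀ a c u → F a c u ≡ G a c u) → Σ³ F ≡ Σ³ G
  Σ³-cong F≗G = ΣF-cong l λ a → ΣF-cong m λ c → ΣF-cong n (F≗G a c)

  Σ³-sub : (F G : Fin l → Fin m → Fin n → ℚ) → Σ³ (λ a c u → F a c u - G a c u) ≡ Σ³ F - Σ³ G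
  Σ³-sub F G = trans (ΣF-cong l λ a → trans (ΣF-cong m λ c → ΣF-sub n _ _) (ΣF-sub m _ _)) (ΣF-sub l _ _)

  Σ³-*ˡ : ∀ k (F : Fin l → Fin m → Fin n → ℚ) → Σ³ (λ a c u → k * F a c u) ≡ k * Σ³ F
  Σ³-*ˡ k F = trans (ΣF-cong l λ a → trans (ΣF-cong m λ c → ΣF-*ˡ n k _) (ΣF-*ˡ m k _)) (ΣF-*ˡ l k _)

  Σ³-pos : {F : Fin l → Fin m → Fin n → ℚ} → (∀ a c u → 0ℚ ≤q F a c u) →
           ∀ a c u → 0ℚ <q F a c u → 0ℚ <q Σ³ F
  Σ³-pos F≥0 a c u F>0 =
    ΣF-pos l (λ a → ΣF-nonneg m λ c → ΣF-nonneg n (F≥0 a c)) a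
      (ΣF-pos m (λ c → ΣF-nonneg n (F≥0 a c)) c (ΣF-pos n (F≥0 a c) u F>0))

  Σ³-single : ∀ {F : Fin l → Fin m → Fin n → ℚ} a c u →
              (∀ a′ c′ u′ → ¬ (a′ ≡ a × c′ ≡ c × u′ ≡ u) → F a′ c′ u′ ≡ 0ℚ) → Σ³ F ≡ F a c u
  Σ³-single a c u F≗0 =
    trans (ΣF-single l a λ a′ a′≢a → ΣF-zero m λ c′ → ΣF-zero n λ u′ → F≗0 a′ c′ u′ (a′≢a ∘ proj₁))
   (trans (ΣF-single m c λ c′ c′≢c → ΣF-zero n λ u′ → F≗0 a c′ u′ (c′≢c ∘ proj₁ ∘ proj₂))
          (ΣF-single n u λ u′ u′≢u → F≗0 a c u′ (u′≢u ∘ proj₂ ∘ proj₂)))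

module _ {N : ℕ} where

  Σpt-cong : {f g : Pt N → ℚ} → (∀ p → f p ≡ g p) → Σpt f ≡ Σpt g
  Σpt-cong f≗g = Σ³-cong λ a c u → f≗g (pt a c u)

  Σpt-sub : (f g : Pt N → ℚ) → Σpt (λ p → f p - g p) ≡ Σpt f - Σpt g
  Σpt-sub f g = Σ³-sub (λ a c u → f (pt a c u)) (λ a c u → g (pt a c u))

  Σpt-*ˡ : ∀ k (f : Pt N → ℚ) → Σpt (λ p → k * f p) ≡ k * Σpt f
  Σpt-*ˡ k f = Σ³-*ˡ k (λ a c u → f (pt a c u))

  Σpt-pos : {f : Pt N → ℚ} → (∀ p → 0ℚ ≤q f p) → ∀ x → 0ℚ <q f x → 0ℚ <q Σpt f
  Σpt-pos f≥0 x = Σ³-pos (λ a c u → f≥0 (pt a c u)) (src x) (off x) (shift x)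

  Σpt-single : ∀ (f : Pt N → ℚ) p → (∀ x → x ≢ p → f x ≡ 0ℚ) → Σpt f ≡ f p
  Σpt-single f p f≗0 = Σ³-single (src p) (off p) (shift p)
    λ a c u ≢p → f≗0 (pt a c u) λ { refl → ≢p (refl , refl , refl) }

  Σpt-pair : ∀ (f : Pt N → ℚ) {p q} → p ≢ q → (∀ x → x ≢ p → x ≢ q → f x ≡ 0ℚ) →
             Σpt f ≡ f p + f q
  Σpt-pair f {p} {q} p≢q f≗0 = begin
    Σpt f                                ≡⟨ solve 2 (λ a b → a := (a :- b) :+ b) refl (Σpt f) (Σpt f|q) ⟩
    (Σpt f - Σpt f|q) + Σpt f|q          ≡⟨ cong (_+ Σpt f|q) (Σpt-sub f f|q) ⟨
    Σpt (λ x → f x - f|q x) + Σpt f|q    ≡⟨ cong₂ _+_ (Σpt-single _ p off-p) (Σpt-single f|q q λ _ → f|q-off) ⟩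
    (f p - f|q p) + f|q q                ≡⟨ cong₂ _+_ (cong (λ y → f p - y) (f|q-off p≢q)) f|q-on ⟩
    (f p - 0ℚ) + f q                     ≡⟨ cong (_+ f q) (ℚ.+-identityʳ (f p)) ⟩
    f p + f q                            ∎
    where
    open ≡-Reasoning
    f|q : Pt N → ℚ
    f|q x = 𝟙 ⌊ x ≟Pt q ⌋ * f x
    f|q-on : f|q q ≡ f q
    f|q-on = trans (cong (_* f q) (𝟙-yes (q ≟Pt q) refl)) (ℚ.*-identityˡ (f q))
    f|q-off : ∀ {x} → x ≢ q → f|q x ≡ 0ℚ
    f|q-off {x} x≢q =
      trans (cong (_* f x) (𝟙-no (x ≟Pt q) x≢q)) (ℚ.*-zeroˡ (f x))
    off-p : ∀ x → x ≢ p → f x - f|q x ≡ 0ℚ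
    off-p x x≢p with x ≟Pt q
    ... | yes refl = trans (cong (λ y → f q - y) (ℚ.*-identityˡ (f q))) (ℚ.+-inverseʳ (f q))
    ... | no x≢q   = trans (cong₂ _-_ (f≗0 x x≢p x≢q) (ℚ.*-zeroˡ (f x))) (ℚ.+-inverseʳ 0ℚ)

-- Affine dependences

module _ {N : ℕ} where

  coord≢1⇒≡0 : ∀ (x : Pt N) k → coord x k ≢ 1ℚ → coord x k ≡ 0ℚ
  coord≢1⇒≡0 x (eC a)     = 𝟙≢1⇒𝟙≡0 _
  coord≢1⇒≡0 x (fC c d u) = 𝟙≢1⇒𝟙≡0 _

  coord-eC≡1⇔ : ∀ (x : Pt N) a → coord x (eC a) ≡ 1ℚ ⇔ src x ≡ a
  coord-eC≡1⇔ x a = 𝟙≡1⇔T _ ⟨⇔⟩ T-⌊⌋ (src x ≟ a)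

  coord-fC≡1⇔ : ∀ (x : Pt N) c d u → coord x (fC c d u) ≡ 1ℚ ⇔
                (c < d × (IsPt c d u x ⊎ (tgt x ≡ c × src x ≡ d × opposite (shift x) ≡ u)))
  coord-fC≡1⇔ x c d u =
    𝟙≡1⇔T _ ⟨⇔⟩ T-∧ {⌊ c <? d ⌋} ⟨⇔⟩ (T-⌊⌋ (c <? d) ×-⇔ (T-∨ {isPt c d u x} ⟨⇔⟩
      (T-⌊⌋∧³ (src x ≟ c) (tgt x ≟ d) (shift x ≟ u)
       ⊎-⇔ T-⌊⌋∧³ (tgt x ≟ c) (src x ≟ d) (opposite (shift x) ≟ u))))

  edge-coord≡1⇔ : ∀ (x y : Pt N) → src x < tgt x →
                  coord y (fC (src x) (tgt x) (shift x)) ≡ 1ℚ ⇔ (y ≡ x ⊎ y ≡ partner x)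
  edge-coord≡1⇔ x y src<tgt = coord-fC≡1⇔ y _ _ _ ⟨⇔⟩ mk⇔
    (λ { (_ , inj₁ (src≡ , tgt≡ , shift≡)) → inj₁ (Pt-≡ src≡ tgt≡ shift≡)
       ; (_ , inj₂ (tgt≡ , src≡ , shift≡)) → inj₂ (Pt-≡ src≡ (trans tgt≡ (sym (partner-tgt x)))
           (trans (sym (opposite-involutive (shift y))) (cong opposite shift≡))) })
    (λ { (inj₁ refl) → src<tgt , inj₁ (refl , refl , refl)
       ; (inj₂ refl) → src<tgt , inj₂ (partner-tgt x , refl , opposite-involutive (shift x)) })

  combo-sub : (v w : Pt N → ℚ) → ∀ k → combo (λ p → v p - w p) k ≡ combo v k - combo w k
  combo-sub v w k = trans
    (Σpt-cong λ p → solve 3 (λ a b c → (a :- b) :* c := a :* c :- b :* c) refl (v p) (w p) (coord p k))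
    (Σpt-sub (λ p → v p * coord p k) (λ p → w p * coord p k))

  combo-pair : ∀ (μ : Pt N → ℚ) k {p q} → p ≢ q → coord p k ≡ 1ℚ → coord q k ≡ 1ℚ →
               (∀ x → x ≢ p → x ≢ q → μ x ≡ 0ℚ ⊎ coord x k ≡ 0ℚ) → combo μ k ≡ μ p + μ q
  combo-pair μ k p≢q p-on q-on rest =
    trans (Σpt-pair _ p≢q term≡0) (cong₂ _+_ (term≡μ p-on) (term≡μ q-on))
    where
    term≡μ : ∀ {x} → coord x k ≡ 1ℚ → μ x * coord x k ≡ μ x
    term≡μ {x} on = trans (cong (μ x *_) on) (ℚ.*-identityʳ (μ x))
    term≡0 : ∀ x → x ≢ _ → x ≢ _ → μ x * coord x k ≡ 0ℚ
    term≡0 x x≢p x≢q with rest x x≢p x≢q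
    ... | inj₁ μ≡0 = trans (cong (_* coord x k) μ≡0) (ℚ.*-zeroˡ (coord x k))
    ... | inj₂ c≡0 = trans (cong (μ x *_) c≡0) (ℚ.*-zeroʳ (μ x))

  partner-sum : ∀ (μ : Pt N → ℚ) → (∀ k → combo μ k ≡ 0ℚ) →
                ∀ x → src x < tgt x → μ x + μ (partner x) ≡ 0ℚ
  partner-sum μ combo≡0 x src<tgt =
    trans (sym (combo-pair μ k (≢-partner x) (shared (inj₁ refl)) (shared (inj₂ refl)) unshared))
          (combo≡0 k)
    where
    k = fC (src x) (tgt x) (shift x)
    shared : ∀ {y} → y ≡ x ⊎ y ≡ partner x → coord y k ≡ 1ℚ
    shared {y} = from (edge-coord≡1⇔ x y src<tgt)
    unshared : ∀ y → y ≢ x → y ≢ partner x → μ y ≡ 0ℚ ⊎ coord y k ≡ 0ℚ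
    unshared y y≢x y≢x′ = inj₂ (coord≢1⇒≡0 y k ([ y≢x , y≢x′ ] ∘ to (edge-coord≡1⇔ x y src<tgt)))

  partner-opposite : ∀ (μ : Pt N → ℚ) → (∀ k → combo μ k ≡ 0ℚ) → ∀ x → μ (partner x) ≡ - μ x
  partner-opposite μ combo≡0 x with <-cmp (src x) (tgt x)
  ... | tri< src<tgt _ _ = inverseʳ-unique _ _ (partner-sum μ combo≡0 x src<tgt)
  ... | tri≈ _ src≡tgt _ = contradiction (sym src≡tgt) (punchInᵢ≢i (src x) (off x))
  ... | tri> _ _ tgt<src = inverseˡ-unique _ _ (begin
    μ (partner x) + μ x                     ≡⟨ cong (λ y → μ (partner x) + μ y) (partner-involutive x) ⟨
    μ (partner x) + μ (partner (partner x)) ≡⟨ partner-sum μ combo≡0 (partner x) x′-src<tgt ⟩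
    0ℚ                                      ∎)
    where
    open ≡-Reasoning
    x′-src<tgt : src (partner x) < tgt (partner x)
    x′-src<tgt = subst (tgt x <_) (sym (partner-tgt x)) tgt<src

module _ {N : ℕ} where

  AffineDependence : Subset N → Subset N → (Pt N → ℚ) → Set
  AffineDependence Yp Ym μ =
    (∀ p → T (Yp p) → 0ℚ <q μ p) × (∀ p → T (Ym p) → μ p <q 0ℚ)
    × SupportedIn μ (Yp ∪ Ym) × (Σpt μ ≡ 0ℚ) × (∀ k → combo μ k ≡ 0ℚ)

module SignPattern {N : ℕ} (f : Pt N → ℚ) {A B : Subset N}
  (pos-on : ∀ {x} → T (A x) → 0ℚ <q f x) (neg-on : ∀ {x} → T (B x) → f x <q 0ℚ)
  (zero-off : ∀ {x} → ¬ T (A x) → ¬ T (B x) → f x ≡ 0ℚ) where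

  ∈A⇔pos : ∀ x → T (A x) ⇔ 0ℚ <q f x
  ∈A⇔pos x = mk⇔ pos-on pos⇒A
    where
    pos⇒A : 0ℚ <q f x → T (A x)
    pos⇒A f>0 with T? (A x) | T? (B x)
    ... | yes x∈A | _       = x∈A
    ... | no _    | yes x∈B = contradiction f>0 (ℚ.<-asym (neg-on x∈B))
    ... | no x∉A  | no x∉B  = contradiction (sym (zero-off x∉A x∉B)) (λ 0≡f → ℚ.<-irrefl 0≡f f>0)

  ∈B⇔neg : ∀ x → T (B x) ⇔ f x <q 0ℚ
  ∈B⇔neg x = mk⇔ neg-on neg⇒B
    where
    neg⇒B : f x <q 0ℚ → T (B x)
    neg⇒B f<0 with T? (A x) | T? (B x)
    ... | _       | yes x∈B = x∈B
    ... | yes x∈A | no _    = contradiction f<0 (ℚ.<-asym (pos-on x∈A))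
    ... | no x∉A  | no x∉B  = contradiction (zero-off x∉A x∉B) (λ f≡0 → ℚ.<-irrefl f≡0 f<0)

module Dependence {N : ℕ} {Yp Ym : Subset N} {μ : Pt N → ℚ} (dep : AffineDependence Yp Ym μ) where

  positive-on : ∀ p → T (Yp p) → 0ℚ <q μ p
  positive-on = proj₁ dep

  negative-on : ∀ p → T (Ym p) → μ p <q 0ℚ
  negative-on = proj₁ (proj₂ dep)

  supported : SupportedIn μ (Yp ∪ Ym)
  supported = proj₁ (proj₂ (proj₂ dep))

  Σμ≡0 : Σpt μ ≡ 0ℚ
  Σμ≡0 = proj₁ (proj₂ (proj₂ (proj₂ dep)))

  combo≡0 : ∀ k → combo μ k ≡ 0ℚ
  combo≡0 = proj₂ (proj₂ (proj₂ (proj₂ dep)))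

  μ≡0-off : ∀ {x} → ¬ T (Yp x) → ¬ T (Ym x) → μ x ≡ 0ℚ
  μ≡0-off {x} x∉Yp x∉Ym = supported x (from (T-not {Yp x ∨ Ym x}) ([ x∉Yp , x∉Ym ] ∘ to (T-∨ {Yp x})))

  Yp⇔pos : ∀ x → T (Yp x) ⇔ 0ℚ <q μ x
  Yp⇔pos = SignPattern.∈A⇔pos μ (positive-on _) (negative-on _) μ≡0-off

  Ym⇔neg : ∀ x → T (Ym x) ⇔ μ x <q 0ℚ
  Ym⇔neg = SignPattern.∈B⇔neg μ (positive-on _) (negative-on _) μ≡0-off

  ≐-by-signs : ∀ {A B : Subset N} → (∀ {x} → T (A x) → 0ℚ <q μ x) → (∀ {x} → T (B x) → μ x <q 0ℚ) →
               (∀ {x} → ¬ T (A x) → ¬ T (B x) → μ x ≡ 0ℚ) → Yp ≐ A × Ym ≐ B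
  ≐-by-signs pos neg off =
    (λ x → T-injective (Yp⇔pos x ⟨⇔⟩ ⇔-sym (∈A⇔pos x))) ,
    (λ x → T-injective (Ym⇔neg x ⟨⇔⟩ ⇔-sym (∈B⇔neg x)))
    where open SignPattern μ pos neg off

  partner∈Ym : ∀ {x} → T (Yp x) → T (Ym (partner x))
  partner∈Ym {x} x∈Yp = from (Ym⇔neg (partner x))
    (subst (_<q 0ℚ) (sym (partner-opposite μ combo≡0 x)) (ℚ.neg-antimono-< (positive-on x x∈Yp)))

  ¬AffIndep : ∀ {y} → T (Yp y) → ¬ AffIndep (Yp ∪ Ym)
  ¬AffIndep {y} y∈Yp indep = ℚ.<-irrefl (sym (indep μ supported Σμ≡0 combo≡0 y)) (positive-on y y∈Yp)

-- Triangulations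

module Barycentre {N : ℕ} (B : Subset N) {b : Pt N} (b∈B : T (B b)) where

  opaque
    size : ℚ
    size = Σpt (𝟙 ∘ B)

    size>0 : 0ℚ <q size
    size>0 = Σpt-pos (𝟙-nonneg ∘ B) b (subst (0ℚ <q_) (sym (from (𝟙≡1⇔T (B b)) b∈B)) (ℚ.positive⁻¹ 1ℚ))

    Σ𝟙≡size : Σpt (𝟙 ∘ B) ≡ size
    Σ𝟙≡size = refl

  instance
    size-positive : Positive size
    size-positive = positive size>0

    size-nonZero : NonZero size
    size-nonZero = ℚ.pos⇒nonZero size

  weight : Pt N → ℚ
  weight p = 1/ size * 𝟙 (B p)

  weight-on : ∀ {p} → T (B p) → 0ℚ <q weight p
  weight-on {p} p∈B = subst (0ℚ <q_) weight≡ (ℚ.positive⁻¹ (1/ size) {{ℚ.1/pos⇒pos size}})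
    where
    weight≡ : 1/ size ≡ weight p
    weight≡ = sym (trans (cong (1/ size *_) (from (𝟙≡1⇔T (B p)) p∈B)) (ℚ.*-identityʳ (1/ size)))

  weight-off : ∀ {p} → ¬ T (B p) → weight p ≡ 0ℚ
  weight-off {p} p∉B =
    trans (cong (1/ size *_) (𝟙≢1⇒𝟙≡0 (B p) (p∉B ∘ to (𝟙≡1⇔T (B p))))) (ℚ.*-zeroʳ (1/ size))

  weight-nonneg : ∀ p → 0ℚ ≤q weight p
  weight-nonneg p with T? (B p)
  ... | yes p∈B = ℚ.<⇒≤ (weight-on p∈B)
  ... | no  p∉B = ℚ.≤-reflexive (sym (weight-off p∉B))

  weight-sum : Σpt weight ≡ 1ℚ
  weight-sum = trans (Σpt-*ˡ (1/ size) (𝟙 ∘ B)) (trans (cong (1/ size *_) Σ𝟙≡size) (ℚ.*-inverseˡ size))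

  barycentre : Point N
  barycentre = combo weight

  barycentre∈conv : InConv B barycentre
  barycentre∈conv = weight , weight-nonneg , (λ _ → weight-off ∘ to T-not) , weight-sum , λ _ → refl

  barycentre∈conv-full : InConv full barycentre
  barycentre∈conv-full = weight , weight-nonneg , (λ _ ()) , weight-sum , λ _ → refl

module Triangulation {N : ℕ} {𝒯 : Coll N} (tri : IsTriangulation 𝒯) where

  down-closed : ∀ σ τ → 𝒯 σ → τ ⊆ σ → 𝒯 τ
  down-closed = proj₁ tri

  independent : ∀ σ → 𝒯 σ → AffIndep σ
  independent = proj₁ (proj₂ tri)

  covering : ∀ (x : Point N) → InConv full x → ∃[ σ ] (𝒯 σ × InConv σ x)
  covering = proj₁ (proj₂ (proj₂ tri))

  meeting : ∀ σ τ (x : Point N) → 𝒯 σ → 𝒯 τ → InConv σ x → InConv τ x → InConv (σ ∩ τ) x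
  meeting = proj₂ (proj₂ (proj₂ tri))

  -- A second convex representation of the barycentre of S, supported in S ∩ τ, must coincide
  -- with the barycentric weights since S is independent; those weights vanish nowhere on S.
  barycentre-⊆ : ∀ {S τ b} (b∈S : T (S b)) → 𝒯 S → 𝒯 τ →
                 InConv τ (Barycentre.barycentre S b∈S) → S ⊆ τ
  barycentre-⊆ {S} {τ} b∈S S∈𝒯 τ∈𝒯 x∈τ p p∈S = decidable-stable (T? (τ p)) λ p∉τ →
    ℚ.<-irrefl (sym (trans (weight≡w p) (w-supp p (∉∩ (λ (_ , p∈τ) → p∉τ p∈τ))))) (weight-on p∈S)
    where
    open Barycentre S b∈S
    x∈S∩τ = meeting S τ barycentre S∈𝒯 τ∈𝒯 barycentre∈conv x∈τ
    w = proj₁ x∈S∩τ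
    w-supp = proj₁ (proj₂ (proj₂ x∈S∩τ))
    w-sum = proj₁ (proj₂ (proj₂ (proj₂ x∈S∩τ)))
    w-combo = proj₂ (proj₂ (proj₂ (proj₂ x∈S∩τ)))
    ∉∩ : ∀ {q} → ¬ (T (S q) × T (τ q)) → T (not ((S ∩ τ) q))
    ∉∩ {q} q∉ = from (T-not {(S ∩ τ) q}) (q∉ ∘ to (T-∧ {S q}))
    weight≡w : ∀ q → weight q ≡ w q
    weight≡w q = x∙y⁻¹≈ε⇒x≈y _ _ (independent S S∈𝒯 (λ q → weight q - w q)
      (λ q q∉S → let q∉S = to T-not q∉S in
         trans (cong₂ _-_ (weight-off q∉S) (w-supp q (∉∩ (q∉S ∘ proj₁)))) (ℚ.+-inverseʳ 0ℚ))
      (trans (Σpt-sub weight w) (trans (cong₂ _-_ weight-sum w-sum) (ℚ.+-inverseʳ 1ℚ)))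
      (λ k → trans (combo-sub weight w k)
               (trans (cong (λ y → combo weight k - y) (w-combo k)) (ℚ.+-inverseʳ (combo weight k))))
      q)

  ∅∈𝒯 : 𝒯 ∅
  ∅∈𝒯 = down-closed σ _ σ∈𝒯 λ _ ()
    where
    open Barycentre {N} full {pt zero zero zero} tt
    σ = proj₁ (covering barycentre barycentre∈conv-full)
    σ∈𝒯 = proj₁ (proj₂ (covering barycentre barycentre∈conv-full))

  dec-by-cover : ∀ {S σ b} (b∈S : T (S b)) → 𝒯 σ → InConv σ (Barycentre.barycentre S b∈S) → Dec (𝒯 S)
  dec-by-cover {S} {σ} b∈S σ∈𝒯 x∈σ with ⊆⊎⊈ S σ
  ... | inj₁ S⊆σ             = yes (down-closed σ S σ∈𝒯 S⊆σ)
  ... | inj₂ (p , p∈S , p∉σ) = no λ S∈𝒯 → p∉σ (barycentre-⊆ b∈S S∈𝒯 σ∈𝒯 x∈σ p p∈S)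

  𝒯-dec : ∀ S → Dec (𝒯 S)
  𝒯-dec S with ⊆⊎⊈ S ∅
  ... | inj₁ S⊆∅ = yes (down-closed _ S ∅∈𝒯 S⊆∅)
  ... | inj₂ (b , b∈S , _) =
    let σ , σ∈𝒯 , x∈σ = covering (Barycentre.barycentre S b∈S) (Barycentre.barycentre∈conv-full S b∈S)
    in dec-by-cover b∈S σ∈𝒯 x∈σ

-- Flips

module _ {N : ℕ} where

  Join : Coll N → Coll N → Coll N
  Join ℒ 𝒮 τ = ∃[ ρ ] ∃[ σ ] (ℒ ρ × 𝒮 σ × τ ≐ (ρ ∪ σ))

  ∈-join : ∀ (ρ σ : Subset N) {τ} → τ ≐ (ρ ∪ σ) → ∀ {p} → T (τ p) → T (ρ p) ⊎ T (σ p)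
  ∈-join ρ σ τ≐ρ∪σ {p} p∈τ = to (∈∪⇔ ρ σ) (subst T (τ≐ρ∪σ p) p∈τ)

  drop-maximal : ∀ {Yp Ym : Subset N} {y} → T (Yp y) → MaxIn (TX Yp Ym) ((Yp ∪ Ym) ∖ ｛ y ｝)
  drop-maximal {Yp} {Ym} {y} y∈Yp = (σ₀⊆Y , λ Yp⊆σ₀ → y∉σ₀ (Yp⊆σ₀ y y∈Yp)) , maximal
    where
    σ₀ = (Yp ∪ Ym) ∖ ｛ y ｝
    σ₀⊆Y : σ₀ ⊆ (Yp ∪ Ym)
    σ₀⊆Y p = proj₁ ∘ to (∈∖⇔ (Yp ∪ Ym) ｛ y ｝)
    y∉σ₀ : ¬ T (σ₀ y)
    y∉σ₀ y∈σ₀ = proj₂ (to (∈∖⇔ (Yp ∪ Ym) ｛ y ｝) y∈σ₀) (fromWitness refl)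
    maximal : ∀ τ → TX Yp Ym τ → σ₀ ⊆ τ → τ ⊆ σ₀
    maximal τ (τ⊆Y , Yp⊈τ) σ₀⊆τ p p∈τ = from (∈∖⇔ (Yp ∪ Ym) ｛ y ｝) (τ⊆Y p p∈τ , Yp⊈τ ∘ Yp⊆τ ∘ toWitness)
      where
      Yp⊆τ : p ≡ y → Yp ⊆ τ
      Yp⊆τ refl q q∈Yp with toSum (q ≟Pt p)
      ... | inj₁ refl = p∈τ
      ... | inj₂ q≢p  =
        σ₀⊆τ q (from (∈∖⇔ (Yp ∪ Ym) ｛ y ｝) (from (∈∪⇔ Yp Ym) (inj₁ q∈Yp) , q≢p ∘ toWitness))

module Flip {N : ℕ} {𝒯 : Coll N} (tri : IsTriangulation 𝒯) {Yp Ym : Subset N} {μ : Pt N → ℚ}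
            (dep : AffineDependence Yp Ym μ) {ℒ : Coll N} (flip : HasFlip 𝒯 Yp Ym ℒ) where

  open Triangulation tri
  open Dependence dep

  Y : Subset N
  Y = Yp ∪ Ym

  link⇔ : ∀ {y} → T (Yp y) → ∀ ρ → ℒ ρ ⇔ LinkIn 𝒯 (Y ∖ ｛ y ｝) ρ
  link⇔ y∈Yp ρ = mk⇔ (proj₂ link-iff) (proj₁ link-iff)
    where link-iff = proj₂ flip _ (drop-maximal y∈Yp) ρ

  Yp⊆⇒¬Join : ∀ {τ} → Yp ⊆ τ → ¬ Join ℒ (TX Yp Ym) τ
  Yp⊆⇒¬Join Yp⊆τ (ρ , σ , ρ∈ℒ , (_ , Yp⊈σ) , τ≐ρ∪σ) with ⊆⊎⊈ Yp σ
  ... | inj₁ Yp⊆σ              = Yp⊈σ Yp⊆σ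
  ... | inj₂ (y , y∈Yp , y∉σ) = ¬AffIndep y∈Yp (independent Y (down-closed _ Y σ₀∪ρ∈𝒯 Y⊆σ₀∪ρ))
    where
    σ₀∪ρ∈𝒯 : 𝒯 ((Y ∖ ｛ y ｝) ∪ ρ)
    σ₀∪ρ∈𝒯 = proj₂ (proj₂ (to (link⇔ y∈Yp ρ) ρ∈ℒ))
    y∈ρ : T (ρ y)
    y∈ρ = [ id , (λ y∈σ → contradiction y∈σ y∉σ) ] (∈-join ρ σ τ≐ρ∪σ (Yp⊆τ y y∈Yp))
    Y⊆σ₀∪ρ : Y ⊆ ((Y ∖ ｛ y ｝) ∪ ρ)
    Y⊆σ₀∪ρ p p∈Y with toSum (p ≟Pt y)
    ... | inj₁ refl = from (∈∪⇔ (Y ∖ ｛ y ｝) ρ) (inj₂ y∈ρ)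
    ... | inj₂ p≢y  = from (∈∪⇔ (Y ∖ ｛ y ｝) ρ) (inj₁ (from (∈∖⇔ Y ｛ y ｝) (p∈Y , p≢y ∘ toWitness)))

  ¬link⇒¬Join : ∀ {y τ} → T (Yp y) → ¬ 𝒯 ((Y ∖ ｛ y ｝) ∪ (τ ∖ Y)) → ¬ Join ℒ (TX Yp Ym) τ
  ¬link⇒¬Join {y} {τ} y∈Yp ¬link (ρ , σ , ρ∈ℒ , (σ⊆Y , _) , τ≐ρ∪σ) =
    ¬link (down-closed _ _ (proj₂ (proj₂ (to (link⇔ y∈Yp ρ) ρ∈ℒ))) τ∖Y⊆ρ)
    where
    τ∖Y⊆ρ : ((Y ∖ ｛ y ｝) ∪ (τ ∖ Y)) ⊆ ((Y ∖ ｛ y ｝) ∪ ρ)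
    τ∖Y⊆ρ p h with to (∈∪⇔ (Y ∖ ｛ y ｝) (τ ∖ Y)) h
    ... | inj₁ p∈σ₀  = from (∈∪⇔ (Y ∖ ｛ y ｝) ρ) (inj₁ p∈σ₀)
    ... | inj₂ p∈τ∖Y = from (∈∪⇔ (Y ∖ ｛ y ｝) ρ) (inj₂
      ([ id , (λ p∈σ → contradiction (σ⊆Y p p∈σ) p∉Y) ] (∈-join ρ σ τ≐ρ∪σ p∈τ)))
      where
      p∈τ = proj₁ (to (∈∖⇔ τ Y) p∈τ∖Y)
      p∉Y = proj₂ (to (∈∖⇔ τ Y) p∈τ∖Y)

  link⇒Join⁻ : ∀ {y τ} → T (Yp y) → 𝒯 τ → ¬ (Ym ⊆ τ) → 𝒯 ((Y ∖ ｛ y ｝) ∪ (τ ∖ Y)) →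
               Join ℒ (TX Ym Yp) τ
  link⇒Join⁻ {y} {τ} y∈Yp τ∈𝒯 Ym⊈τ link =
    τ ∖ Y , τ ∩ Y , from (link⇔ y∈Yp (τ ∖ Y)) (disjoint , τ∖Y∈𝒯 , link) , (τ∩Y⊆Y , Ym⊈τ∩Y) , ≐-∖∪∩ τ Y
    where
    disjoint : Disjoint (Y ∖ ｛ y ｝) (τ ∖ Y)
    disjoint p p∈σ₀ p∈τ∖Y = proj₂ (to (∈∖⇔ τ Y) p∈τ∖Y) (proj₁ (to (∈∖⇔ Y ｛ y ｝) p∈σ₀))
    τ∖Y∈𝒯 : 𝒯 (τ ∖ Y)
    τ∖Y∈𝒯 = down-closed τ (τ ∖ Y) τ∈𝒯 λ p → proj₁ ∘ to (∈∖⇔ τ Y)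
    τ∩Y⊆Y : (τ ∩ Y) ⊆ (Ym ∪ Yp)
    τ∩Y⊆Y p = subst T (∨-comm (Yp p) (Ym p)) ∘ proj₂ ∘ to (T-∧ {τ p})
    Ym⊈τ∩Y : ¬ (Ym ⊆ (τ ∩ Y))
    Ym⊈τ∩Y Ym⊆τ∩Y = Ym⊈τ λ p → proj₁ ∘ to (T-∧ {τ p}) ∘ Ym⊆τ∩Y p

  flip-keeps : ∀ {τ} → 𝒯 τ → (Ym ⊆ τ → Yp ⊆ τ) → FlipResult 𝒯 Yp Ym ℒ τ
  flip-keeps {τ} τ∈𝒯 Ym⊆⇒Yp⊆ with ⊆⊎⊈ Yp τ
  ... | inj₁ Yp⊆τ = inj₁ (τ∈𝒯 , Yp⊆⇒¬Join Yp⊆τ)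
  ... | inj₂ (y , y∈Yp , y∉τ) with 𝒯-dec ((Y ∖ ｛ y ｝) ∪ (τ ∖ Y))
  ...   | no  ¬link = inj₁ (τ∈𝒯 , ¬link⇒¬Join y∈Yp ¬link)
  ...   | yes link  = inj₂ (link⇒Join⁻ y∈Yp τ∈𝒯 (λ Ym⊆τ → y∉τ (Ym⊆⇒Yp⊆ Ym⊆τ y y∈Yp)) link)

-- The circuit X_{ijk}^{rst}

module Triangle {N : ℕ} (i j k : Fin 4) (i≢j : i ≢ j) (j≢k : j ≢ k) (k≢i : k ≢ i) (r s t : Shift N) where

  X⁺ X⁻ X : Subset N
  X⁺ = Xplus i j k r s t
  X⁻ = Xminus i j k r s t
  X  = X⁺ ∪ X⁻

  x₁ x₂ x₃ y₁ y₂ y₃ : Pt N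
  x₁ = edgePt i j i≢j r
  x₂ = edgePt j k j≢k s
  x₃ = edgePt k i k≢i t
  y₁ = partner x₁
  y₂ = partner x₂
  y₃ = partner x₃

  Is-x Is-y : Pt N → Set
  Is-x x = x ≡ x₁ ⊎ x ≡ x₂ ⊎ x ≡ x₃
  Is-y x = x ≡ y₁ ⊎ x ≡ y₂ ⊎ x ≡ y₃

  X⁺⇔ : ∀ {x} → T (X⁺ x) ⇔ Is-x x
  X⁺⇔ {x} = T-∨ {isPt i j r x} {isPt j k s x ∨ isPt k i t x} ⟨⇔⟩ (isPt⇔≡edgePt i≢j ⊎-⇔
            (T-∨ {isPt j k s x} {isPt k i t x} ⟨⇔⟩ (isPt⇔≡edgePt j≢k ⊎-⇔ isPt⇔≡edgePt k≢i)))

  X⁻⇔ : ∀ {x} → T (X⁻ x) ⇔ Is-y x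
  X⁻⇔ {x} = T-∨ {isPt j i (opposite r) x} {isPt k j (opposite s) x ∨ isPt i k (opposite t) x} ⟨⇔⟩
            (isPt⇔≡partner {u = r} i≢j ⊎-⇔ (T-∨ {isPt k j (opposite s) x} {isPt i k (opposite t) x} ⟨⇔⟩
            (isPt⇔≡partner {u = s} j≢k ⊎-⇔ isPt⇔≡partner {u = t} k≢i)))

  X⇔ : ∀ {x} → T (X x) ⇔ (Is-x x ⊎ Is-y x)
  X⇔ {x} = ∈∪⇔ X⁺ X⁻ {x} ⟨⇔⟩ (X⁺⇔ {x} ⊎-⇔ X⁻⇔ {x})

  partner-X : ∀ {x} → T (X (partner x)) → T (X x)
  partner-X {x} x′∈X = from (X⇔ {x}) ([ inj₂ ∘ y-of-x , inj₁ ∘ x-of-y ]′ (to (X⇔ {partner x}) x′∈X))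
    where
    y-of-x : Is-x (partner x) → Is-y x
    y-of-x = Sum.map partner-swap (Sum.map partner-swap partner-swap)
    x-of-y : Is-y (partner x) → Is-x x
    x-of-y = Sum.map partner-injective (Sum.map partner-injective partner-injective)

  src-y₁ : src y₁ ≡ j
  src-y₁ = edgePt-tgt {N} i≢j r

  src-y₂ : src y₂ ≡ k
  src-y₂ = edgePt-tgt {N} j≢k s

  src-y₃ : src y₃ ≡ i
  src-y₃ = edgePt-tgt {N} k≢i t

  src-clash : ∀ {a} {x p : Pt N} → x ≡ p → src x ≡ a → src p ≡ a
  src-clash x≡p x↦a = trans (cong src (sym x≡p)) x↦a

  X-at-i : ∀ {x} → T (X x) → src x ≡ i → x ≡ x₁ ⊎ x ≡ y₃
  X-at-i x∈X x↦i with to X⇔ x∈X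
  ... | inj₁ (inj₁ x≡x₁)        = inj₁ x≡x₁
  ... | inj₁ (inj₂ (inj₁ x≡x₂)) = contradiction (src-clash x≡x₂ x↦i) (≢-sym i≢j)
  ... | inj₁ (inj₂ (inj₂ x≡x₃)) = contradiction (src-clash x≡x₃ x↦i) k≢i
  ... | inj₂ (inj₁ x≡y₁)        = contradiction (trans (sym src-y₁) (src-clash x≡y₁ x↦i)) (≢-sym i≢j)
  ... | inj₂ (inj₂ (inj₁ x≡y₂)) = contradiction (trans (sym src-y₂) (src-clash x≡y₂ x↦i)) k≢i
  ... | inj₂ (inj₂ (inj₂ x≡y₃)) = inj₂ x≡y₃

  X-at-j : ∀ {x} → T (X x) → src x ≡ j → x ≡ x₂ ⊎ x ≡ y₁
  X-at-j x∈X x↦j with to X⇔ x∈X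
  ... | inj₁ (inj₁ x≡x₁)        = contradiction (src-clash x≡x₁ x↦j) i≢j
  ... | inj₁ (inj₂ (inj₁ x≡x₂)) = inj₁ x≡x₂
  ... | inj₁ (inj₂ (inj₂ x≡x₃)) = contradiction (src-clash x≡x₃ x↦j) (≢-sym j≢k)
  ... | inj₂ (inj₁ x≡y₁)        = inj₂ x≡y₁
  ... | inj₂ (inj₂ (inj₁ x≡y₂)) = contradiction (trans (sym src-y₂) (src-clash x≡y₂ x↦j)) (≢-sym j≢k)
  ... | inj₂ (inj₂ (inj₂ x≡y₃)) = contradiction (trans (sym src-y₃) (src-clash x≡y₃ x↦j)) i≢j

  x₁≢y₃ : x₁ ≢ y₃
  x₁≢y₃ x₁≡y₃ = j≢k (trans (sym (edgePt-tgt {N} i≢j r)) (trans (cong tgt x₁≡y₃) (partner-tgt x₃)))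

  x₂≢y₁ : x₂ ≢ y₁
  x₂≢y₁ x₂≡y₁ = k≢i (trans (sym (edgePt-tgt {N} j≢k s)) (trans (cong tgt x₂≡y₁) (partner-tgt x₁)))

  module _ {Yp Ym : Subset N} {μ : Pt N → ℚ} (dep : AffineDependence Yp Ym μ) (Ym⊆X : Ym ⊆ X) where

    open Dependence dep

    Yp⊆X : Yp ⊆ X
    Yp⊆X x x∈Yp = partner-X {x} (Ym⊆X (partner x) (partner∈Ym x∈Yp))

    μ≡0-off-X : ∀ {x} → ¬ T (X x) → μ x ≡ 0ℚ
    μ≡0-off-X {x} x∉X = μ≡0-off (x∉X ∘ Yp⊆X x) (x∉X ∘ Ym⊆X x)

    vertex-sum : ∀ a {p q} → p ≢ q → src p ≡ a → src q ≡ a →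
                 (∀ {x} → T (X x) → src x ≡ a → x ≡ p ⊎ x ≡ q) → μ p + μ q ≡ 0ℚ
    vertex-sum a {p} {q} p≢q p↦a q↦a at-a = trans
      (sym (combo-pair μ (eC a) p≢q (from (coord-eC≡1⇔ p a) p↦a) (from (coord-eC≡1⇔ q a) q↦a) others))
      (combo≡0 (eC a))
      where
      others : ∀ x → x ≢ p → x ≢ q → μ x ≡ 0ℚ ⊎ coord x (eC a) ≡ 0ℚ
      others x x≢p x≢q with toSum (T? (X x)) | toSum (src x ≟ a)
      ... | inj₂ x∉X | _        = inj₁ (μ≡0-off-X x∉X)
      ... | inj₁ x∈X | inj₁ x↦a = contradiction (at-a x∈X x↦a) [ x≢p , x≢q ]
      ... | inj₁ _   | inj₂ x↦̸a = inj₂ (coord≢1⇒≡0 x (eC a) (x↦̸a ∘ to (coord-eC≡1⇔ x a)))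

    μx₃≡μx₁ : μ x₃ ≡ μ x₁
    μx₃≡μx₁ = sym (x∙y⁻¹≈ε⇒x≈y _ _ (begin
      μ x₁ + - μ x₃  ≡⟨ cong (μ x₁ +_) (partner-opposite μ combo≡0 x₃) ⟨
      μ x₁ + μ y₃    ≡⟨ vertex-sum i x₁≢y₃ refl src-y₃ X-at-i ⟩
      0ℚ             ∎))
      where open ≡-Reasoning

    μx₂≡μx₁ : μ x₂ ≡ μ x₁
    μx₂≡μx₁ = x∙y⁻¹≈ε⇒x≈y _ _ (begin
      μ x₂ + - μ x₁  ≡⟨ cong (μ x₂ +_) (partner-opposite μ combo≡0 x₁) ⟨
      μ x₂ + μ y₁    ≡⟨ vertex-sum j x₂≢y₁ refl src-y₁ X-at-j ⟩
      0ℚ             ∎)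
      where open ≡-Reasoning

    μ-on-x : ∀ {x} → Is-x x → μ x ≡ μ x₁
    μ-on-x (inj₁ x≡x₁)        = cong μ x≡x₁
    μ-on-x (inj₂ (inj₁ x≡x₂)) = trans (cong μ x≡x₂) μx₂≡μx₁
    μ-on-x (inj₂ (inj₂ x≡x₃)) = trans (cong μ x≡x₃) μx₃≡μx₁

    μ-on-y : ∀ {x} → Is-y x → μ x ≡ - μ x₁
    μ-on-y (inj₁ x≡y₁)        = trans (cong μ x≡y₁) (partner-opposite μ combo≡0 x₁)
    μ-on-y (inj₂ (inj₁ x≡y₂)) =
      trans (cong μ x≡y₂) (trans (partner-opposite μ combo≡0 x₂) (cong -_ μx₂≡μx₁))
    μ-on-y (inj₂ (inj₂ x≡y₃)) =
      trans (cong μ x≡y₃) (trans (partner-opposite μ combo≡0 x₃) (cong -_ μx₃≡μx₁))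

    μ≡0-off-X⁺X⁻ : ∀ {x} → ¬ T (X⁺ x) → ¬ T (X⁻ x) → μ x ≡ 0ℚ
    μ≡0-off-X⁺X⁻ {x} x∉X⁺ x∉X⁻ = μ≡0-off-X ([ x∉X⁺ , x∉X⁻ ]′ ∘ to (∈∪⇔ X⁺ X⁻ {x}))

    classification : ∀ {y} → T (Yp y) → (Yp ≐ X⁺ × Ym ≐ X⁻) ⊎ (Yp ≐ X⁻ × Ym ≐ X⁺)
    classification {y} y∈Yp with ℚ.<-cmp 0ℚ (μ x₁)
    ... | tri< μx₁>0 _ _ = inj₁ (≐-by-signs
          (λ x∈X⁺ → subst (0ℚ <q_) (sym (μ-on-x (to X⁺⇔ x∈X⁺))) μx₁>0)
          (λ x∈X⁻ → subst (_<q 0ℚ) (sym (μ-on-y (to X⁻⇔ x∈X⁻))) (ℚ.neg-antimono-< μx₁>0))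
          μ≡0-off-X⁺X⁻)
    ... | tri> _ _ μx₁<0 = inj₂ (≐-by-signs
          (λ x∈X⁻ → subst (0ℚ <q_) (sym (μ-on-y (to X⁻⇔ x∈X⁻))) (ℚ.neg-antimono-< μx₁<0))
          (λ x∈X⁺ → subst (_<q 0ℚ) (sym (μ-on-x (to X⁺⇔ x∈X⁺))) μx₁<0)
          (λ x∉X⁻ x∉X⁺ → μ≡0-off-X⁺X⁻ x∉X⁺ x∉X⁻))
    ... | tri≈ _ 0≡μx₁ _ = contradiction (positive-on y y∈Yp) (ℚ.<-irrefl (sym μy≡0))
      where
      μy≡0 : μ y ≡ 0ℚ
      μy≡0 with to (X⇔ {y}) (Yp⊆X y y∈Yp)
      ... | inj₁ y-is-x = trans (μ-on-x y-is-x) (sym 0≡μx₁)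
      ... | inj₂ y-is-y = trans (μ-on-y y-is-y) (cong -_ (sym 0≡μx₁))

proposition4p5 : (N : ℕ) → 1 ≤ N → (i j k : Fin 4) → i ≢ j → j ≢ k → i ≢ k
    → (r s t : Shift N) → (𝒯 𝒯' : Coll N) → IsTriangulation 𝒯
    → (∀ σ → TX (Xplus i j k r s t) (Xminus i j k r s t) σ → 𝒯 σ)
    → (∃[ Yp ] ∃[ Ym ] (IsFlipOn 𝒯 𝒯' Yp Ym
        × ¬ ((Yp ≐ Xplus i j k r s t) × (Ym ≐ Xminus i j k r s t))))
    → ∀ σ → TX (Xplus i j k r s t) (Xminus i j k r s t) σ → 𝒯' σ
proposition4p5 N _ i j k i≢j j≢k i≢k r s t 𝒯 𝒯' tri T⁺⊆𝒯
                (Yp , Ym , (((_ , dep) , _) , ℒ , flip , 𝒯'⇔) , Y≢X) τ τ∈T⁺@(τ⊆X , X⁺⊈τ) =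
  proj₂ (𝒯'⇔ τ) (Flip.flip-keeps tri dep flip (T⁺⊆𝒯 τ τ∈T⁺) Ym⊆τ⇒Yp⊆τ)
  where
  open Triangle {N} i j k i≢j j≢k (≢-sym i≢k) r s t
  Ym⊆τ⇒Yp⊆τ : Ym ⊆ τ → Yp ⊆ τ
  Ym⊆τ⇒Yp⊆τ Ym⊆τ y y∈Yp with classification dep (λ x → τ⊆X x ∘ Ym⊆τ x) y∈Yp
  ... | inj₁ Y≐X           = contradiction Y≐X Y≢X
  ... | inj₂ (_ , Ym≐X⁺) = contradiction (λ x → Ym⊆τ x ∘ subst T (sym (Ym≐X⁺ x))) X⁺⊈τ
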